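{- The only prime power $q$ satisfying $q \equiv 0 \pmod 5$ and $d(\mathbb{F}_q) = -19$ is $q = 5^7$.
   Context: For a prime power $q$, the discriminant of the finite field $\mathbb{F}_q$ is $d(\mathbb{F}_q) := \lfloor 2\sqrt{q}\rfloor^2 - 4q$. -}

module Defs where

open import Data.Nat using (ℕ; zero; suc; _+_; _*_; _^_; _≤?_)
open import Data.Nat.Primality using (Prime)
open import Data.Product using (∃-syntax; _×_)
open import Data.Integer using (ℤ; +_; _-_)
open import Relation.Binary.PropositionalEquality using (_≡_)
open import Relation.Nullary using (yes; no)

IsPrimePower : ℕ → Set
IsPrimePower q = ∃[ p ] ∃[ k ] (Prime p × q ≡ p ^ (suc k))

isqrtFrom : ℕ → ℕ → ℕ
isqrtFrom zero    n = zero
isqrtFrom (suc m) n with suc m * suc m ≤? n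
... | yes _ = suc m
... | no  _ = isqrtFrom m n

isqrt : ℕ → ℕ
isqrt n = isqrtFrom n n

-- ⌊2√q⌋ = ⌊√(4q)⌋
floor2sqrt : ℕ → ℕ
floor2sqrt q = isqrt (4 * q)

disc : ℕ → ℤ
disc q = + (floor2sqrt q * floor2sqrt q) - + (4 * q)

{-# OPTIONS --safe #-}
module Submission where

-- If d(F_q) = -19 then m² + 19 = 4q for m = ⌊2√q⌋, and 5 ∣ q makes q = 5ⁿ. Then m = 2a + 1 is odd
-- and a² + a + 5 = 5ⁿ: a + ω has norm 5ⁿ in ℤ[ω], ω = (1 + √-19)/2. As 5 = ωω̄ and 5 ∤ a + ω, a
-- descent on n gives a + ω = ±ωⁿ or ±ω̄ⁿ, so the ω-coefficient Uₙ of ωⁿ is ±1. From ω¹⁶ = 1 + 51δ,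
-- Uₙ mod 51 depends only on n mod 16, which leaves n ≡ 1, 2, 7 (mod 16) with Uₙ = 1. Writing
-- n = r + 16·3ᵉs with 3 ∤ s, the expansion ω^(16·3ᵉ) = 1 + 3^(e+1)(β + 3γ), β = 17δ, gives
-- Uₙ ≡ U_r + 3^(e+1)·s·c₁(ωʳβ) (mod 3^(e+2)), and 3 ∤ c₁(ωʳβ) for r = 1, 2, 7; hence n ∈ {1, 2, 7}.
-- Finally q = 5 and q = 25 have d(F_q) = -4 and 0.

open import Defs
open import Data.Nat using (ℕ; _^_; _%_)
open import Data.Integer using (ℤ; -[1+_])
open import Relation.Binary.PropositionalEquality using (_≡_)
open import Function.Bundles using (_⇔_)
open import Data.Product using (_×_)

open import Algebra.Bundles using (CommutativeRing; Semiring)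
import Algebra.Definitions.RawMagma as RawMagmaDefinitions
import Algebra.Definitions.RawSemiring as RawSemiringDefinitions
import Algebra.Properties.Ring as RingProperties
import Algebra.Properties.Semiring.Exp as SemiringExp
open import Data.Fin using (Fin; toℕ)
open import Data.Fin.Patterns using (0F; 1F)
open import Data.Fin.Properties using (all?)
open import Data.Integer using (+_; +0; _+_; _*_; -_; _-_; ∣_∣)
open import Data.Integer.Divisibility.Signed using (_∣_; divides; _∣?_; ∣ᵤ⇒∣; ∣⇒∣ᵤ)
import Data.Integer.Properties as ℤ
open import Data.Integer.Tactic.RingSolver using (solve-∀)
open import Data.Maybe using (just; nothing)
open import Data.Nat using (zero; suc)
import Data.Nat as ℕ
import Data.Nat.Divisibility as ℕ
open import Data.Nat.DivMod using (result; _divMod_)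
open import Data.Nat.Induction using (<-rec)
import Data.Nat.Properties as ℕ
open import Data.Nat.Primality using (Prime; euclidsLemma; prime⇒irreducible; prime?; ¬prime[1])
import Data.Nat.Tactic.RingSolver as ℕ
open import Data.Product using (∃-syntax; _,_; proj₁; proj₂; map₁; map₂)
open import Data.Sum using (_⊎_; inj₁; inj₂)
import Data.Sum as Sum
open import Function using (_∘_; id; case_of_)
open import Function.Bundles using (mk⇔)
open import Level using (0ℓ)
open import Relation.Binary.PropositionalEquality
  using (_≢_; refl; sym; trans; cong; cong₂; subst; subst₂; isEquivalence; module ≡-Reasoning)
open import Relation.Nullary using (¬_; yes; no; contradiction)
open import Relation.Nullary.Decidable using (from-yes; from-no; ¬?; _×-dec_; _⊎-dec_; _→-dec_)
import Tactic.RingSolver as RingSolver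
open import Tactic.RingSolver.Core.AlmostCommutativeRing
  using (AlmostCommutativeRing; fromCommutativeRing)

open RingProperties ℤ.+-*-ring using (+-identityʳ-unique)

prime-3 : Prime 3
prime-3 = from-yes (prime? 3)

prime-5 : Prime 5
prime-5 = from-yes (prime? 5)

ℤ-euclidsLemma : ∀ {p} → Prime p → ∀ x y → + p ∣ x * y → (+ p ∣ x) ⊎ (+ p ∣ y)
ℤ-euclidsLemma {p} p-prime x y p∣xy =
  Sum.map ∣ᵤ⇒∣ ∣ᵤ⇒∣ (euclidsLemma ∣ x ∣ ∣ y ∣ p-prime (subst (p ℕ.∣_) (ℤ.abs-* x y) (∣⇒∣ᵤ p∣xy)))

∣i∣≡1⇒i≡±1 : ∀ i → ∣ i ∣ ≡ 1 → i ≡ + 1 ⊎ i ≡ -[1+ 0 ]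
∣i∣≡1⇒i≡±1 (+ 1)           _  = inj₁ refl
∣i∣≡1⇒i≡±1 -[1+ 0 ]        _  = inj₂ refl
∣i∣≡1⇒i≡±1 (+ 0)           ()
∣i∣≡1⇒i≡±1 (+ suc (suc _)) ()
∣i∣≡1⇒i≡±1 -[1+ suc _ ]    ()

i*i≡∣i∣*∣i∣ : ∀ i → i * i ≡ + (∣ i ∣ ℕ.* ∣ i ∣)
i*i≡∣i∣*∣i∣ (+ n)    = sym (ℤ.pos-* n n)
i*i≡∣i∣*∣i∣ -[1+ n ] = refl

prime∣prime^⇒≡ : ∀ {p r} n → Prime p → Prime r → p ℕ.∣ r ^ n → p ≡ r
prime∣prime^⇒≡ zero p-prime _ p∣1 = contradiction (subst Prime (ℕ.∣1⇒≡1 p∣1) p-prime) ¬prime[1]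
prime∣prime^⇒≡ {r = r} (suc n) p-prime r-prime p∣r^[1+n] with euclidsLemma r (r ^ n) p-prime p∣r^[1+n]
... | inj₁ p∣r   = Sum.[ (λ p≡1 → contradiction (subst Prime p≡1 p-prime) ¬prime[1]) , id ]′
                         (prime⇒irreducible r-prime p∣r)
... | inj₂ p∣r^n = prime∣prime^⇒≡ n p-prime r-prime p∣r^n

split-off-power : ∀ p {t} → 1 ℕ.< p → 0 ℕ.< t → ∃[ e ] ∃[ s ] t ≡ p ^ e ℕ.* s × ¬ p ℕ.∣ s
split-off-power p {t} 1<p = <-rec P split t
  where
  P : ℕ → Set
  P t = 0 ℕ.< t → ∃[ e ] ∃[ s ] t ≡ p ^ e ℕ.* s × ¬ p ℕ.∣ s
  reassoc : ∀ x s p → x ℕ.* s ℕ.* p ≡ p ℕ.* x ℕ.* s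
  reassoc = ℕ.solve-∀
  split : ∀ t → (∀ {u} → u ℕ.< t → P u) → P t
  split t rec 0<t with p ℕ.∣? t
  ... | no p∤t                         = 0 , t , sym (ℕ.+-identityʳ t) , p∤t
  ... | yes (ℕ.divides zero refl)      = contradiction 0<t λ ()
  ... | yes (ℕ.divides u@(suc _) refl) =
    let e , s , u≡ , p∤s = rec (ℕ.m<m*n u p 1<p) (ℕ.s≤s ℕ.z≤n)
    in  suc e , s , trans (cong (ℕ._* p) u≡) (reassoc (p ^ e) s p) , p∤s

-- The ring ℤ[ω]

-- a ∔ b ·ω stands for a + bω with ω = (1 + √-19)/2, so that ω² = ω - 5; N is the norm and conj the
-- conjugation ω ↦ ω̄ = 1 - ω.

infix  5 _∔_·ω
infixl 6 _⊕_
infixl 7 _⊗_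
infix  8 ⊖_

record ℤ[ω] : Set where
  constructor _∔_·ω
  field
    c₀ c₁ : ℤ

open ℤ[ω]

_⊕_ _⊗_ : ℤ[ω] → ℤ[ω] → ℤ[ω]
(a ∔ b ·ω) ⊕ (c ∔ d ·ω) = a + c ∔ b + d ·ω
(a ∔ b ·ω) ⊗ (c ∔ d ·ω) = a * c - + 5 * (b * d) ∔ a * d + b * c + b * d ·ω

⊖_ : ℤ[ω] → ℤ[ω]
⊖ (a ∔ b ·ω) = - a ∔ - b ·ω

𝟘 𝟙 ω : ℤ[ω]
𝟘 = +0 ∔ +0 ·ω
𝟙 = + 1 ∔ +0 ·ω
ω = +0 ∔ + 1 ·ω

ι : ℤ → ℤ[ω]
ι k = k ∔ +0 ·ω

conj : ℤ[ω] → ℤ[ω]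
conj (a ∔ b ·ω) = a + b ∔ - b ·ω

ω̄ : ℤ[ω]
ω̄ = conj ω

N : ℤ[ω] → ℤ
N (a ∔ b ·ω) = a * a + a * b + + 5 * (b * b)
ℤ[ω]-commutativeRing : CommutativeRing 0ℓ 0ℓ
ℤ[ω]-commutativeRing = record
  { Carrier           = ℤ[ω]
  ; _≈_               = _≡_
  ; _+_               = _⊕_
  ; _*_               = _⊗_
  ; -_                = ⊖_
  ; 0#                = 𝟘
  ; 1#                = 𝟙
  ; isCommutativeRing = record
    { isRing = record
      { +-isAbelianGroup = record
        { isGroup = record
          { isMonoid = record
            { isSemigroup = record
              { isMagma = record { isEquivalence = isEquivalence ; ∙-cong = cong₂ _⊕_ }
              ; assoc   = ⊕-assoc
              }
            ; identity = ⊕-identityˡ , ⊕-identityʳ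
            }
          ; inverse = ⊖-inverseˡ , ⊖-inverseʳ
          ; ⁻¹-cong = cong ⊖_
          }
        ; comm = ⊕-comm
        }
      ; *-cong     = cong₂ _⊗_
      ; *-assoc    = ⊗-assoc
      ; *-identity = ⊗-identityˡ , λ x → trans (⊗-comm x 𝟙) (⊗-identityˡ x)
      ; distrib    = (λ x y z → trans (⊗-comm x (y ⊕ z)) (trans (⊗-distribʳ-⊕ x y z)
                                  (cong₂ _⊕_ (⊗-comm y x) (⊗-comm z x))))
                   , ⊗-distribʳ-⊕
      }
    ; *-comm = ⊗-comm
    }
  }
  where
  ⊕-assoc : ∀ x y z → x ⊕ y ⊕ z ≡ x ⊕ (y ⊕ z)
  ⊕-assoc (a ∔ b ·ω) (c ∔ d ·ω) (e ∔ f ·ω) = cong₂ _∔_·ω (ℤ.+-assoc a c e) (ℤ.+-assoc b d f)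

  ⊕-comm : ∀ x y → x ⊕ y ≡ y ⊕ x
  ⊕-comm (a ∔ b ·ω) (c ∔ d ·ω) = cong₂ _∔_·ω (ℤ.+-comm a c) (ℤ.+-comm b d)

  ⊕-identityˡ : ∀ x → 𝟘 ⊕ x ≡ x
  ⊕-identityˡ (a ∔ b ·ω) = cong₂ _∔_·ω (ℤ.+-identityˡ a) (ℤ.+-identityˡ b)

  ⊕-identityʳ : ∀ x → x ⊕ 𝟘 ≡ x
  ⊕-identityʳ (a ∔ b ·ω) = cong₂ _∔_·ω (ℤ.+-identityʳ a) (ℤ.+-identityʳ b)

  ⊖-inverseˡ : ∀ x → ⊖ x ⊕ x ≡ 𝟘
  ⊖-inverseˡ (a ∔ b ·ω) = cong₂ _∔_·ω (ℤ.+-inverseˡ a) (ℤ.+-inverseˡ b)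

  ⊖-inverseʳ : ∀ x → x ⊕ ⊖ x ≡ 𝟘
  ⊖-inverseʳ (a ∔ b ·ω) = cong₂ _∔_·ω (ℤ.+-inverseʳ a) (ℤ.+-inverseʳ b)

  ⊗-comm : ∀ x y → x ⊗ y ≡ y ⊗ x
  ⊗-comm (a ∔ b ·ω) (c ∔ d ·ω) = cong₂ _∔_·ω (c₀-comm a b c d) (c₁-comm a b c d)
    where
    c₀-comm : ∀ a b c d → a * c - + 5 * (b * d) ≡ c * a - + 5 * (d * b)
    c₀-comm = solve-∀
    c₁-comm : ∀ a b c d → a * d + b * c + b * d ≡ c * b + d * a + d * b
    c₁-comm = solve-∀

  ⊗-identityˡ : ∀ x → 𝟙 ⊗ x ≡ x
  ⊗-identityˡ (a ∔ b ·ω) = cong₂ _∔_·ω (c₀-identity a b) (c₁-identity a b)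
    where
    c₀-identity : ∀ a b → + 1 * a - + 5 * (+0 * b) ≡ a
    c₀-identity = solve-∀
    c₁-identity : ∀ a b → + 1 * b + +0 * a + +0 * b ≡ b
    c₁-identity = solve-∀

  ⊗-assoc : ∀ x y z → x ⊗ y ⊗ z ≡ x ⊗ (y ⊗ z)
  ⊗-assoc (a ∔ b ·ω) (c ∔ d ·ω) (e ∔ f ·ω) = cong₂ _∔_·ω (c₀-assoc a b c d e f) (c₁-assoc a b c d e f)
    where
    c₀-assoc : ∀ a b c d e f →
      (a * c - + 5 * (b * d)) * e - + 5 * ((a * d + b * c + b * d) * f) ≡
      a * (c * e - + 5 * (d * f)) - + 5 * (b * (c * f + d * e + d * f))
    c₀-assoc = solve-∀
    c₁-assoc : ∀ a b c d e f →
      (a * c - + 5 * (b * d)) * f + (a * d + b * c + b * d) * e + (a * d + b * c + b * d) * f ≡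
      a * (c * f + d * e + d * f) + b * (c * e - + 5 * (d * f)) + b * (c * f + d * e + d * f)
    c₁-assoc = solve-∀

  ⊗-distribʳ-⊕ : ∀ x y z → (y ⊕ z) ⊗ x ≡ y ⊗ x ⊕ z ⊗ x
  ⊗-distribʳ-⊕ (a ∔ b ·ω) (c ∔ d ·ω) (e ∔ f ·ω) =
    cong₂ _∔_·ω (c₀-distrib a b c d e f) (c₁-distrib a b c d e f)
    where
    c₀-distrib : ∀ a b c d e f →
      (c + e) * a - + 5 * ((d + f) * b) ≡ (c * a - + 5 * (d * b)) + (e * a - + 5 * (f * b))
    c₀-distrib = solve-∀
    c₁-distrib : ∀ a b c d e f →
      (c + e) * b + (d + f) * a + (d + f) * b ≡ (c * b + d * a + d * b) + (e * b + f * a + f * b)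
    c₁-distrib = solve-∀

ℤ[ω]-almostCommutativeRing : AlmostCommutativeRing 0ℓ 0ℓ
ℤ[ω]-almostCommutativeRing = fromCommutativeRing ℤ[ω]-commutativeRing λ
  { (+0 ∔ +0 ·ω) → just refl
  ; _            → nothing
  }

open CommutativeRing ℤ[ω]-commutativeRing
  using (semiring; ring) renaming (*-comm to ⊗-comm; *-assoc to ⊗-assoc)
open RawSemiringDefinitions (Semiring.rawSemiring semiring)
  using () renaming (_^_ to _↑_; _∣_ to _∣ω_; _∤_ to _∤ω_)
open RawMagmaDefinitions (CommutativeRing.*-rawMagma ℤ[ω]-commutativeRing) using (_,_)
open SemiringExp semiring using (^-homo-*; ^-assocʳ)
open RingProperties ring using (-‿distribˡ-*)

ι-⊗ : ∀ a b → ι (a * b) ≡ ι a ⊗ ι b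
ι-⊗ a b = cong₂ _∔_·ω (c₀-ι a b) (c₁-ι a b)
  where
  c₀-ι : ∀ a b → a * b ≡ a * b - + 5 * (+0 * +0)
  c₀-ι = solve-∀
  c₁-ι : ∀ a b → +0 ≡ a * +0 + +0 * b + +0 * +0
  c₁-ι = solve-∀

c₁-ι⊗ : ∀ k x → c₁ (ι k ⊗ x) ≡ k * c₁ x
c₁-ι⊗ k (a ∔ b ·ω) = identity k a b
  where
  identity : ∀ k a b → k * b + +0 * a + +0 * b ≡ k * b
  identity = solve-∀

N-⊗ : ∀ x y → N (x ⊗ y) ≡ N x * N y
N-⊗ (a ∔ b ·ω) (c ∔ d ·ω) = identity a b c d
  where
  identity : ∀ a b c d →
    let e = a * c - + 5 * (b * d); f = a * d + b * c + b * d in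
    e * e + e * f + + 5 * (f * f) ≡ (a * a + a * b + + 5 * (b * b)) * (c * c + c * d + + 5 * (d * d))
  identity = solve-∀

N-conj : ∀ x → N (conj x) ≡ N x
N-conj (a ∔ b ·ω) = identity a b
  where
  identity : ∀ a b → (a + b) * (a + b) + (a + b) * - b + + 5 * (- b * - b) ≡ a * a + a * b + + 5 * (b * b)
  identity = solve-∀

conj-involutive : ∀ x → conj (conj x) ≡ x
conj-involutive (a ∔ b ·ω) = cong₂ _∔_·ω (identity a b) (ℤ.neg-involutive b)
  where
  identity : ∀ a b → a + b + - b ≡ a
  identity = solve-∀

conj-⊖ : ∀ x → conj (⊖ x) ≡ ⊖ conj x
conj-⊖ (a ∔ b ·ω) = cong₂ _∔_·ω (sym (ℤ.neg-distrib-+ a b)) refl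

conj-⊗ : ∀ x y → conj (x ⊗ y) ≡ conj x ⊗ conj y
conj-⊗ (a ∔ b ·ω) (c ∔ d ·ω) = cong₂ _∔_·ω (c₀-conj a b c d) (c₁-conj a b c d)
  where
  c₀-conj : ∀ a b c d →
    (a * c - + 5 * (b * d)) + (a * d + b * c + b * d) ≡ (a + b) * (c + d) - + 5 * (- b * - d)
  c₀-conj = solve-∀
  c₁-conj : ∀ a b c d →
    - (a * d + b * c + b * d) ≡ (a + b) * - d + - b * (c + d) + - b * - d
  c₁-conj = solve-∀

conj-↑ : ∀ x n → conj (x ↑ n) ≡ conj x ↑ n
conj-↑ x zero    = refl
conj-↑ x (suc n) = trans (conj-⊗ x (x ↑ n)) (cong (conj x ⊗_) (conj-↑ x n))

conj-∣ω : ∀ {d x} → d ∣ω x → conj d ∣ω conj x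
conj-∣ω {d} (q , refl) = conj q , sym (conj-⊗ q d)

infix 4 _≈±_
_≈±_ : ℤ[ω] → ℤ[ω] → Set
x ≈± y = x ≡ y ⊎ x ≡ ⊖ y

≈±-⊗ʳ : ∀ {x y} z → x ≈± y → x ⊗ z ≈± y ⊗ z
≈±-⊗ʳ z (inj₁ refl)         = inj₁ refl
≈±-⊗ʳ {y = y} z (inj₂ refl) = inj₂ (sym (-‿distribˡ-* y z))

≈±-conj : ∀ {x y} → x ≈± y → conj x ≈± conj y
≈±-conj (inj₁ refl)         = inj₁ refl
≈±-conj {y = y} (inj₂ refl) = inj₂ (conj-⊖ y)

∣ω-≈± : ∀ {d x y} → d ∣ω y → x ≈± y → d ∣ω x
∣ω-≈± d∣y (inj₁ refl)            = d∣y
∣ω-≈± {d} (q , refl) (inj₂ refl) = ⊖ q , sym (-‿distribˡ-* q d)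

-- Elements of norm 5ⁿ

N≡1⇒c₁≡0 : ∀ x → N x ≡ + 1 → c₁ x ≡ +0
N≡1⇒c₁≡0 (a ∔ b ·ω) N≡1 = ℤ.∣i∣≡0⇒i≡0 (Sum.reduce (ℕ.m*n≡0⇒m≡0∨n≡0 ∣ b ∣ ∣b∣²≡0))
  where
  open ≡-Reasoning
  completing-the-square : ∀ a b →
    (+ 2 * a + b) * (+ 2 * a + b) + + 19 * (b * b) ≡ + 4 * (a * a + a * b + + 5 * (b * b))
  completing-the-square = solve-∀
  u = + 2 * a + b
  squares : + (∣ u ∣ ℕ.* ∣ u ∣ ℕ.+ 19 ℕ.* (∣ b ∣ ℕ.* ∣ b ∣)) ≡ + 4
  squares = begin
    + (∣ u ∣ ℕ.* ∣ u ∣) + + (19 ℕ.* (∣ b ∣ ℕ.* ∣ b ∣))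
      ≡⟨ cong₂ _+_ (sym (i*i≡∣i∣*∣i∣ u))
                   (trans (ℤ.pos-* 19 (∣ b ∣ ℕ.* ∣ b ∣)) (cong (+ 19 *_) (sym (i*i≡∣i∣*∣i∣ b)))) ⟩
    u * u + + 19 * (b * b)  ≡⟨ completing-the-square a b ⟩
    + 4 * N (a ∔ b ·ω)      ≡⟨ cong (+ 4 *_) N≡1 ⟩
    + 4                     ∎
  m+19n≡4⇒n≡0 : ∀ m n → m ℕ.+ 19 ℕ.* n ≡ 4 → n ≡ 0
  m+19n≡4⇒n≡0 m zero    _  = refl
  m+19n≡4⇒n≡0 m (suc n) eq = contradiction
    (subst (19 ℕ.≤_) eq (ℕ.≤-trans (ℕ.m≤m*n 19 (suc n)) (ℕ.m≤n+m _ m)))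
    (from-no (19 ℕ.≤? 4))
  ∣b∣²≡0 : ∣ b ∣ ℕ.* ∣ b ∣ ≡ 0
  ∣b∣²≡0 = m+19n≡4⇒n≡0 (∣ u ∣ ℕ.* ∣ u ∣) (∣ b ∣ ℕ.* ∣ b ∣) (ℤ.+-injective squares)

N≡1⇒≈±𝟙 : ∀ x → N x ≡ + 1 → x ≈± 𝟙
N≡1⇒≈±𝟙 x@(a ∔ b ·ω) N≡1 with N≡1⇒c₁≡0 x N≡1
... | refl = Sum.map (cong (_∔ +0 ·ω)) (cong (_∔ +0 ·ω)) (∣i∣≡1⇒i≡±1 a ∣a∣≡1)
  where
  identity : ∀ a → a * a + a * +0 + + 5 * (+0 * +0) ≡ a * a
  identity = solve-∀
  ∣a∣≡1 : ∣ a ∣ ≡ 1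
  ∣a∣≡1 = ℕ.m*n≡1⇒m≡1 ∣ a ∣ ∣ a ∣ (ℤ.+-injective (trans (sym (i*i≡∣i∣*∣i∣ a)) (trans (sym (identity a)) N≡1)))

5∣c₀⇒ω∣ : ∀ x → + 5 ∣ c₀ x → ω ∣ω x
5∣c₀⇒ω∣ (a ∔ b ·ω) (divides a′ refl) = a′ + b ∔ - a′ ·ω , cong₂ _∔_·ω (c₀-eq a′ b) (c₁-eq a′ b)
  where
  c₀-eq : ∀ a′ b → (a′ + b) * +0 - + 5 * (- a′ * + 1) ≡ a′ * + 5
  c₀-eq = solve-∀
  c₁-eq : ∀ a′ b → (a′ + b) * + 1 + - a′ * +0 + - a′ * + 1 ≡ b
  c₁-eq = solve-∀

5∣c₀[c₀+c₁] : ∀ n x → N x ≡ + (5 ^ suc n) → + 5 ∣ c₀ x * (c₀ x + c₁ x)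
5∣c₀[c₀+c₁] n (a ∔ b ·ω) N≡ = divides (+ (5 ^ n) - b * b) (begin
  a * (a + b)                                      ≡⟨ split-norm a b ⟩
  a * a + a * b + + 5 * (b * b) - + 5 * (b * b)    ≡⟨ cong (_- + 5 * (b * b)) N≡ ⟩
  + (5 ^ suc n) - + 5 * (b * b)                    ≡⟨ cong (_- + 5 * (b * b)) (ℤ.pos-* 5 (5 ^ n)) ⟩
  + 5 * + (5 ^ n) - + 5 * (b * b)                  ≡⟨ factor-5 (+ (5 ^ n)) b ⟩
  (+ (5 ^ n) - b * b) * + 5                        ∎)
  where
  open ≡-Reasoning
  split-norm : ∀ a b → a * (a + b) ≡ a * a + a * b + + 5 * (b * b) - + 5 * (b * b)
  split-norm = solve-∀
  factor-5 : ∀ m b → + 5 * m - + 5 * (b * b) ≡ (m - b * b) * + 5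
  factor-5 = solve-∀

5∣ω̄↑suc⊗ω : ∀ n → ι (+ 5) ∣ω ω̄ ↑ suc n ⊗ ω
5∣ω̄↑suc⊗ω n = ω̄ ↑ n , ω̄ω≡5 (ω̄ ↑ n)
  where
  ω̄ω≡5 : ∀ v → v ⊗ ι (+ 5) ≡ ω̄ ⊗ v ⊗ ω
  ω̄ω≡5 = RingSolver.solve-∀ ℤ[ω]-almostCommutativeRing

descent-step : ∀ n → (∀ y → N y ≡ + (5 ^ n) → ι (+ 5) ∤ω y → y ≈± ω ↑ n ⊎ y ≈± ω̄ ↑ n) →
               ∀ x → ω ∣ω x → N x ≡ + (5 ^ suc n) → ι (+ 5) ∤ω x → x ≈± ω ↑ suc n ⊎ x ≈± ω̄ ↑ suc n
descent-step n descent-n _ (y , refl) N≡ 5∤yω = inj₁ (lift n (descent-n y Ny≡5ⁿ 5∤y))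
  where
  open ≡-Reasoning
  Ny≡5ⁿ : N y ≡ + (5 ^ n)
  Ny≡5ⁿ = ℤ.*-cancelʳ-≡ (N y) (+ (5 ^ n)) (+ 5) (begin
    N y * + 5        ≡⟨ N-⊗ y ω ⟨
    N (y ⊗ ω)        ≡⟨ N≡ ⟩
    + (5 ^ suc n)    ≡⟨ ℤ.pos-* 5 (5 ^ n) ⟩
    + 5 * + (5 ^ n)  ≡⟨ ℤ.*-comm (+ 5) (+ (5 ^ n)) ⟩
    + (5 ^ n) * + 5  ∎)
  5∤y : ι (+ 5) ∤ω y
  5∤y (q , refl) = 5∤yω (q ⊗ ω , swap q)
    where
    swap : ∀ q → q ⊗ ω ⊗ ι (+ 5) ≡ q ⊗ ι (+ 5) ⊗ ω
    swap = RingSolver.solve-∀ ℤ[ω]-almostCommutativeRing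
  lift : ∀ n → y ≈± ω ↑ n ⊎ y ≈± ω̄ ↑ n → y ⊗ ω ≈± ω ↑ suc n
  lift n (inj₁ y≈ω↑n)      = subst (y ⊗ ω ≈±_) (⊗-comm (ω ↑ n) ω) (≈±-⊗ʳ ω y≈ω↑n)
  lift zero (inj₂ y≈𝟙)     = ≈±-⊗ʳ ω y≈𝟙
  lift (suc n) (inj₂ y≈ω̄↑) = contradiction (∣ω-≈± (5∣ω̄↑suc⊗ω n) (≈±-⊗ʳ ω y≈ω̄↑)) 5∤yω

conj-swap : ∀ {x} n → conj x ≈± ω ↑ n ⊎ conj x ≈± ω̄ ↑ n → x ≈± ω ↑ n ⊎ x ≈± ω̄ ↑ n
conj-swap {x} n (inj₁ x̄≈) = inj₂ (subst₂ _≈±_ (conj-involutive x) (conj-↑ ω n) (≈±-conj x̄≈))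
conj-swap {x} n (inj₂ x̄≈) = inj₁ (subst₂ _≈±_ (conj-involutive x) (conj-↑ ω̄ n) (≈±-conj x̄≈))

-- a(a + b) = N(a + bω) - 5b², so either 5 ∣ a and ω ∣ a + bω, or 5 ∣ a + b and ω ∣ conj (a + bω).
descent : ∀ n x → N x ≡ + (5 ^ n) → ι (+ 5) ∤ω x → x ≈± ω ↑ n ⊎ x ≈± ω̄ ↑ n
descent zero    x N≡1 _   = inj₁ (N≡1⇒≈±𝟙 x N≡1)
descent (suc n) x N≡ 5∤x with ℤ-euclidsLemma prime-5 (c₀ x) (c₀ x + c₁ x) (5∣c₀[c₀+c₁] n x N≡)
... | inj₁ 5∣c₀    = descent-step n (descent n) x (5∣c₀⇒ω∣ x 5∣c₀) N≡ 5∤x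
... | inj₂ 5∣c₀+c₁ = conj-swap (suc n) (descent-step n (descent n) (conj x) (5∣c₀⇒ω∣ (conj x) 5∣c₀+c₁)
                       (trans (N-conj x) N≡) (5∤x ∘ subst (ι (+ 5) ∣ω_) (conj-involutive x) ∘ conj-∣ω))

-- The ω-coefficients Uₙ of ωⁿ

U : ℕ → ℤ
U n = c₁ (ω ↑ n)

binomial : ∀ M y s → ∃[ z ] (𝟙 ⊕ M ⊗ y) ↑ s ≡ 𝟙 ⊕ M ⊗ (ι (+ s) ⊗ y ⊕ M ⊗ z)
binomial M y zero = 𝟘 , base M y
  where
  base : ∀ M y → 𝟙 ≡ 𝟙 ⊕ M ⊗ (ι (+ 0) ⊗ y ⊕ M ⊗ 𝟘)
  base = RingSolver.solve-∀ ℤ[ω]-almostCommutativeRing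
binomial M y (suc s) with binomial M y s
... | z , eq = z ⊕ ι (+ s) ⊗ y ⊗ y ⊕ M ⊗ y ⊗ z , trans (cong ((𝟙 ⊕ M ⊗ y) ⊗_) eq) (step M (ι (+ s)) y z)
  where
  step : ∀ M S y z → (𝟙 ⊕ M ⊗ y) ⊗ (𝟙 ⊕ M ⊗ (S ⊗ y ⊕ M ⊗ z)) ≡
                     𝟙 ⊕ M ⊗ ((𝟙 ⊕ S) ⊗ y ⊕ M ⊗ (z ⊕ S ⊗ y ⊗ y ⊕ M ⊗ y ⊗ z))
  step = RingSolver.solve-∀ ℤ[ω]-almostCommutativeRing

U-+ : ∀ r k m y → ω ↑ k ≡ 𝟙 ⊕ ι m ⊗ y → U (r ℕ.+ k) ≡ U r + m * c₁ (ω ↑ r ⊗ y)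
U-+ r k m y ω↑k≡ = begin
  c₁ (ω ↑ (r ℕ.+ k))               ≡⟨ cong c₁ (^-homo-* ω r k) ⟩
  c₁ (ω ↑ r ⊗ ω ↑ k)               ≡⟨ cong (λ w → c₁ (ω ↑ r ⊗ w)) ω↑k≡ ⟩
  c₁ (ω ↑ r ⊗ (𝟙 ⊕ ι m ⊗ y))      ≡⟨ cong c₁ (distribute (ω ↑ r) (ι m) y) ⟩
  c₁ (ω ↑ r ⊕ ι m ⊗ (ω ↑ r ⊗ y))  ≡⟨ cong (_+_ (U r)) (c₁-ι⊗ m (ω ↑ r ⊗ y)) ⟩
  U r + m * c₁ (ω ↑ r ⊗ y)         ∎
  where
  open ≡-Reasoning
  distribute : ∀ w M y → w ⊗ (𝟙 ⊕ M ⊗ y) ≡ w ⊕ M ⊗ (w ⊗ y)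
  distribute = RingSolver.solve-∀ ℤ[ω]-almostCommutativeRing

δ : ℤ[ω]
δ = -[1+ 7630 ] ∔ + 1581 ·ω

ω↑16 : ω ↑ 16 ≡ 𝟙 ⊕ ι (+ 51) ⊗ δ
ω↑16 = refl

U-periodic : ∀ r t → + 51 ∣ U (r ℕ.+ t ℕ.* 16) - U r
U-periodic r t with binomial (ι (+ 51)) δ t
... | z , eq = divides (c₁ (ω ↑ r ⊗ v)) (begin
  U (r ℕ.+ t ℕ.* 16) - U r                ≡⟨ cong (_- U r) (U-+ r (t ℕ.* 16) (+ 51) v ω↑16t) ⟩
  U r + + 51 * c₁ (ω ↑ r ⊗ v) - U r       ≡⟨ cancel (U r) (c₁ (ω ↑ r ⊗ v)) ⟩
  c₁ (ω ↑ r ⊗ v) * + 51                   ∎)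
  where
  open ≡-Reasoning
  v = ι (+ t) ⊗ δ ⊕ ι (+ 51) ⊗ z
  ω↑16t : ω ↑ (t ℕ.* 16) ≡ 𝟙 ⊕ ι (+ 51) ⊗ v
  ω↑16t = begin
    ω ↑ (t ℕ.* 16)   ≡⟨ cong (ω ↑_) (ℕ.*-comm t 16) ⟩
    ω ↑ (16 ℕ.* t)   ≡⟨ ^-assocʳ ω 16 t ⟨
    (ω ↑ 16) ↑ t     ≡⟨ eq ⟩
    𝟙 ⊕ ι (+ 51) ⊗ v ∎
  cancel : ∀ u c → u + + 51 * c - u ≡ c * + 51
  cancel = solve-∀

β : ℤ[ω]
β = ι (+ 17) ⊗ δ

ι-3^suc : ∀ e → ι (+ (3 ^ suc e)) ≡ ι (+ 3) ⊗ ι (+ (3 ^ e))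
ι-3^suc e = trans (cong ι (ℤ.pos-* 3 (3 ^ e))) (ι-⊗ (+ 3) (+ (3 ^ e)))

cube-lift : ∀ e β γ → ∃[ γ′ ]
  (𝟙 ⊕ ι (+ (3 ^ suc e)) ⊗ (β ⊕ ι (+ 3) ⊗ γ)) ↑ 3 ≡ 𝟙 ⊕ ι (+ (3 ^ suc (suc e))) ⊗ (β ⊕ ι (+ 3) ⊗ γ′)
cube-lift e β γ = γ ⊕ Y ⊗ (a ⊕ a ⊗ a) , (begin
  (𝟙 ⊕ ι (+ (3 ^ suc e)) ⊗ Y) ↑ 3     ≡⟨ cong (λ m → (𝟙 ⊕ m ⊗ Y) ↑ 3) (ι-3^suc e) ⟩
  (𝟙 ⊕ ι (+ 3) ⊗ P ⊗ Y) ↑ 3           ≡⟨ cong (λ w → (𝟙 ⊕ w) ↑ 3) (⊗-assoc (ι (+ 3)) P Y) ⟩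
  (𝟙 ⊕ ι (+ 3) ⊗ a) ↑ 3               ≡⟨ cube a ⟩
  𝟙 ⊕ ι (+ 3) ⊗ (ι (+ 3) ⊗ a) ⊗ (𝟙 ⊕ ι (+ 3) ⊗ (a ⊕ a ⊗ a))
    ≡⟨ cong (𝟙 ⊕_) (regroup P β γ (a ⊕ a ⊗ a)) ⟩
  𝟙 ⊕ ι (+ 3) ⊗ (ι (+ 3) ⊗ P) ⊗ (β ⊕ ι (+ 3) ⊗ (γ ⊕ Y ⊗ (a ⊕ a ⊗ a)))
    ≡⟨ cong (λ m → 𝟙 ⊕ m ⊗ (β ⊕ ι (+ 3) ⊗ (γ ⊕ Y ⊗ (a ⊕ a ⊗ a)))) ι-3^[2+e] ⟨
  𝟙 ⊕ ι (+ (3 ^ suc (suc e))) ⊗ (β ⊕ ι (+ 3) ⊗ (γ ⊕ Y ⊗ (a ⊕ a ⊗ a))) ∎)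
  where
  open ≡-Reasoning
  P = ι (+ (3 ^ e))
  Y = β ⊕ ι (+ 3) ⊗ γ
  a = P ⊗ Y
  cube : ∀ a → (𝟙 ⊕ ι (+ 3) ⊗ a) ⊗ ((𝟙 ⊕ ι (+ 3) ⊗ a) ⊗ ((𝟙 ⊕ ι (+ 3) ⊗ a) ⊗ 𝟙)) ≡
               𝟙 ⊕ ι (+ 3) ⊗ (ι (+ 3) ⊗ a) ⊗ (𝟙 ⊕ ι (+ 3) ⊗ (a ⊕ a ⊗ a))
  cube = RingSolver.solve-∀ ℤ[ω]-almostCommutativeRing
  regroup : ∀ P β γ u → ι (+ 3) ⊗ (ι (+ 3) ⊗ (P ⊗ (β ⊕ ι (+ 3) ⊗ γ))) ⊗ (𝟙 ⊕ ι (+ 3) ⊗ u) ≡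
                        ι (+ 3) ⊗ (ι (+ 3) ⊗ P) ⊗ (β ⊕ ι (+ 3) ⊗ (γ ⊕ (β ⊕ ι (+ 3) ⊗ γ) ⊗ u))
  regroup = RingSolver.solve-∀ ℤ[ω]-almostCommutativeRing
  ι-3^[2+e] : ι (+ (3 ^ suc (suc e))) ≡ ι (+ 3) ⊗ (ι (+ 3) ⊗ P)
  ι-3^[2+e] = trans (ι-3^suc (suc e)) (cong (ι (+ 3) ⊗_) (ι-3^suc e))

ω↑16·3^e : ∀ e → ∃[ γ ] ω ↑ (16 ℕ.* 3 ^ e) ≡ 𝟙 ⊕ ι (+ (3 ^ suc e)) ⊗ (β ⊕ ι (+ 3) ⊗ γ)
ω↑16·3^e zero    = 𝟘 , refl
ω↑16·3^e (suc e) = map₂ (trans ω↑16·3^[1+e]) (cube-lift e β γ)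
  where
  open ≡-Reasoning
  γ = proj₁ (ω↑16·3^e e)
  reassoc : ∀ x → 16 ℕ.* (3 ℕ.* x) ≡ 16 ℕ.* x ℕ.* 3
  reassoc = ℕ.solve-∀
  ω↑16·3^[1+e] : ω ↑ (16 ℕ.* 3 ^ suc e) ≡ (𝟙 ⊕ ι (+ (3 ^ suc e)) ⊗ (β ⊕ ι (+ 3) ⊗ γ)) ↑ 3
  ω↑16·3^[1+e] = begin
    ω ↑ (16 ℕ.* 3 ^ suc e)      ≡⟨ cong (ω ↑_) (reassoc (3 ^ e)) ⟩
    ω ↑ (16 ℕ.* 3 ^ e ℕ.* 3)    ≡⟨ ^-assocʳ ω (16 ℕ.* 3 ^ e) 3 ⟨
    (ω ↑ (16 ℕ.* 3 ^ e)) ↑ 3    ≡⟨ cong (_↑ 3) (proj₂ (ω↑16·3^e e)) ⟩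
    (𝟙 ⊕ ι (+ (3 ^ suc e)) ⊗ (β ⊕ ι (+ 3) ⊗ γ)) ↑ 3 ∎

U-3-adic : ∀ r e s → ∃[ k ]
  U (r ℕ.+ 3 ^ e ℕ.* s ℕ.* 16) ≡ U r + + (3 ^ suc e) * (+ s * c₁ (ω ↑ r ⊗ β) + + 3 * k)
U-3-adic r e s with ω↑16·3^e e
... | γ , eq with binomial (ι (+ (3 ^ suc e))) (β ⊕ ι (+ 3) ⊗ γ) s
...   | z , eq′ = c₁ (ω ↑ r ⊗ g) , (begin
  U (r ℕ.+ 3 ^ e ℕ.* s ℕ.* 16)
    ≡⟨ U-+ r (3 ^ e ℕ.* s ℕ.* 16) m (ι (+ s) ⊗ Y ⊕ ι m ⊗ z) ω↑k ⟩
  U r + m * c₁ (ω ↑ r ⊗ (ι (+ s) ⊗ Y ⊕ ι m ⊗ z))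
    ≡⟨ cong (λ M → U r + m * c₁ (ω ↑ r ⊗ (ι (+ s) ⊗ Y ⊕ M ⊗ z))) (ι-3^suc e) ⟩
  U r + m * c₁ (ω ↑ r ⊗ (ι (+ s) ⊗ Y ⊕ ι (+ 3) ⊗ P ⊗ z))
    ≡⟨ cong (λ w → U r + m * c₁ w) (regroup (ω ↑ r) (ι (+ s)) β γ P z) ⟩
  U r + m * c₁ (ι (+ s) ⊗ (ω ↑ r ⊗ β) ⊕ ι (+ 3) ⊗ (ω ↑ r ⊗ g))
    ≡⟨ cong (λ c → U r + m * c) (cong₂ _+_ (c₁-ι⊗ (+ s) (ω ↑ r ⊗ β)) (c₁-ι⊗ (+ 3) (ω ↑ r ⊗ g))) ⟩
  U r + m * (+ s * c₁ (ω ↑ r ⊗ β) + + 3 * c₁ (ω ↑ r ⊗ g)) ∎)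
  where
  open ≡-Reasoning
  m = + (3 ^ suc e)
  P = ι (+ (3 ^ e))
  Y = β ⊕ ι (+ 3) ⊗ γ
  g = ι (+ s) ⊗ γ ⊕ P ⊗ z
  reassoc : ∀ x s → x ℕ.* s ℕ.* 16 ≡ 16 ℕ.* x ℕ.* s
  reassoc = ℕ.solve-∀
  ω↑k : ω ↑ (3 ^ e ℕ.* s ℕ.* 16) ≡ 𝟙 ⊕ ι m ⊗ (ι (+ s) ⊗ Y ⊕ ι m ⊗ z)
  ω↑k = begin
    ω ↑ (3 ^ e ℕ.* s ℕ.* 16)       ≡⟨ cong (ω ↑_) (reassoc (3 ^ e) s) ⟩
    ω ↑ (16 ℕ.* 3 ^ e ℕ.* s)       ≡⟨ ^-assocʳ ω (16 ℕ.* 3 ^ e) s ⟨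
    (ω ↑ (16 ℕ.* 3 ^ e)) ↑ s       ≡⟨ cong (_↑ s) eq ⟩
    (𝟙 ⊕ ι m ⊗ Y) ↑ s              ≡⟨ eq′ ⟩
    𝟙 ⊕ ι m ⊗ (ι (+ s) ⊗ Y ⊕ ι m ⊗ z) ∎
  regroup : ∀ w S β γ P z → w ⊗ (S ⊗ (β ⊕ ι (+ 3) ⊗ γ) ⊕ ι (+ 3) ⊗ P ⊗ z) ≡
                            S ⊗ (w ⊗ β) ⊕ ι (+ 3) ⊗ (w ⊗ (S ⊗ γ ⊕ P ⊗ z))
  regroup = RingSolver.solve-∀ ℤ[ω]-almostCommutativeRing

U-3-adic-≢ : ∀ r e s → ¬ 3 ℕ.∣ s → ¬ + 3 ∣ c₁ (ω ↑ r ⊗ β) → U (r ℕ.+ 3 ^ e ℕ.* s ℕ.* 16) ≢ U r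
U-3-adic-≢ r e s 3∤s 3∤c U≡Ur = Sum.[ m≢0 , X≢0 ]′ (ℤ.i*j≡0⇒i≡0∨j≡0 (+ (3 ^ suc e)) {X} mX≡0)
  where
  c = c₁ (ω ↑ r ⊗ β)
  k = proj₁ (U-3-adic r e s)
  X = + s * c + + 3 * k
  mX≡0 : + (3 ^ suc e) * X ≡ +0
  mX≡0 = +-identityʳ-unique (U r) (+ (3 ^ suc e) * X) (trans (sym (proj₂ (U-3-adic r e s))) U≡Ur)
  m≢0 : + (3 ^ suc e) ≢ +0
  m≢0 m≡0 = contradiction (ℕ.m^n≡0⇒m≡0 3 (suc e) (ℤ.+-injective m≡0)) λ ()
  solve-for : ∀ x k → x + + 3 * k ≡ +0 → x ≡ - k * + 3
  solve-for x k eq = trans (move x k) (trans (cong (_- + 3 * k) eq) (negate k))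
    where
    move : ∀ x k → x ≡ x + + 3 * k - + 3 * k
    move = solve-∀
    negate : ∀ k → +0 - + 3 * k ≡ - k * + 3
    negate = solve-∀
  X≢0 : X ≢ +0
  X≢0 X≡0 = Sum.[ 3∤s ∘ ∣⇒∣ᵤ , 3∤c ]′
    (ℤ-euclidsLemma prime-3 (+ s) c (divides (- k) (solve-for (+ s * c) k X≡0)))

residues-mod-51 : ∀ (r : Fin 16) →
  (+ 51 ∣ + 1 - U (toℕ r) → + 1 ≡ U (toℕ r) × (toℕ r ≡ 1 ⊎ toℕ r ≡ 2 ⊎ toℕ r ≡ 7)) ×
  ¬ + 51 ∣ -[1+ 0 ] - U (toℕ r)
residues-mod-51 = from-yes (all? λ (r : Fin 16) →
  (+ 51 ∣? + 1 - U (toℕ r) →-dec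
    (+ 1 ℤ.≟ U (toℕ r) ×-dec (toℕ r ℕ.≟ 1 ⊎-dec toℕ r ℕ.≟ 2 ⊎-dec toℕ r ℕ.≟ 7))) ×-dec
  ¬? (+ 51 ∣? -[1+ 0 ] - U (toℕ r)))

3∤c₁[ω↑ρ⊗β] : ∀ {ρ} → ρ ≡ 1 ⊎ ρ ≡ 2 ⊎ ρ ≡ 7 → ¬ + 3 ∣ c₁ (ω ↑ ρ ⊗ β)
3∤c₁[ω↑ρ⊗β] (inj₁ refl)        = from-no (+ 3 ∣? c₁ (ω ↑ 1 ⊗ β))
3∤c₁[ω↑ρ⊗β] (inj₂ (inj₁ refl)) = from-no (+ 3 ∣? c₁ (ω ↑ 2 ⊗ β))
3∤c₁[ω↑ρ⊗β] (inj₂ (inj₂ refl)) = from-no (+ 3 ∣? c₁ (ω ↑ 7 ⊗ β))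

U-aperiodic : ∀ ρ t → ρ ≡ 1 ⊎ ρ ≡ 2 ⊎ ρ ≡ 7 → U (ρ ℕ.+ t ℕ.* 16) ≡ U ρ → t ≡ 0
U-aperiodic ρ zero    _  _     = refl
U-aperiodic ρ (suc t) ρ∈ U≡Uρ with split-off-power 3 {suc t} (ℕ.s≤s (ℕ.s≤s ℕ.z≤n)) (ℕ.s≤s ℕ.z≤n)
... | e , s , t≡ , 3∤s = contradiction (subst (λ t → U (ρ ℕ.+ t ℕ.* 16) ≡ U ρ) t≡ U≡Uρ)
                                       (U-3-adic-≢ ρ e s 3∤s (3∤c₁[ω↑ρ⊗β] ρ∈))

∣U∣≡1⇒ : ∀ n → ∣ U n ∣ ≡ 1 → n ≡ 1 ⊎ n ≡ 2 ⊎ n ≡ 7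
∣U∣≡1⇒ n ∣Un∣≡1 with n divMod 16
... | result t r refl = finish (residue (∣i∣≡1⇒i≡±1 _ ∣Un∣≡1))
  where
  ρ = toℕ r
  51∣Un-Uρ : + 51 ∣ U (ρ ℕ.+ t ℕ.* 16) - U ρ
  51∣Un-Uρ = U-periodic ρ t
  residue : U (ρ ℕ.+ t ℕ.* 16) ≡ + 1 ⊎ U (ρ ℕ.+ t ℕ.* 16) ≡ -[1+ 0 ] →
            U (ρ ℕ.+ t ℕ.* 16) ≡ U ρ × (ρ ≡ 1 ⊎ ρ ≡ 2 ⊎ ρ ≡ 7)
  residue (inj₁ Un≡1) =
    map₁ (trans Un≡1) (proj₁ (residues-mod-51 r) (subst (λ u → + 51 ∣ u - U ρ) Un≡1 51∣Un-Uρ))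
  residue (inj₂ Un≡-1) =
    contradiction (subst (λ u → + 51 ∣ u - U ρ) Un≡-1 51∣Un-Uρ) (proj₂ (residues-mod-51 r))
  finish : U (ρ ℕ.+ t ℕ.* 16) ≡ U ρ × (ρ ≡ 1 ⊎ ρ ≡ 2 ⊎ ρ ≡ 7) →
           ρ ℕ.+ t ℕ.* 16 ≡ 1 ⊎ ρ ℕ.+ t ℕ.* 16 ≡ 2 ⊎ ρ ℕ.+ t ℕ.* 16 ≡ 7
  finish (Un≡Uρ , ρ∈) rewrite U-aperiodic ρ t ρ∈ Un≡Uρ | ℕ.+-identityʳ ρ = ρ∈

-- The equation x² + 19 = 4·5ⁿ

5∤a+ω : ∀ a → ι (+ 5) ∤ω (a ∔ + 1 ·ω)
5∤a+ω a (q , q⊗5≡a+ω) =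
  from-no (+ 5 ∣? + 1) (divides (c₁ q) (trans (cong c₁ (sym q⊗5≡a+ω)) (c₁-⊗5 (c₀ q) (c₁ q))))
  where
  c₁-⊗5 : ∀ a b → a * +0 + b * + 5 + b * +0 ≡ b * + 5
  c₁-⊗5 = solve-∀

∣c₁∣-≈± : ∀ {x y} → x ≈± y → ∣ c₁ x ∣ ≡ ∣ c₁ y ∣
∣c₁∣-≈± (inj₁ refl)         = refl
∣c₁∣-≈± {y = y} (inj₂ refl) = ℤ.∣-i∣≡∣i∣ (c₁ y)

∣U∣≡∣c₁∣ : ∀ {x} n → x ≈± ω ↑ n ⊎ x ≈± ω̄ ↑ n → ∣ U n ∣ ≡ ∣ c₁ x ∣
∣U∣≡∣c₁∣ n (inj₁ x≈ω↑n) = sym (∣c₁∣-≈± x≈ω↑n)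
∣U∣≡∣c₁∣ {x} n (inj₂ x≈ω̄↑n) = begin
  ∣ U n ∣                 ≡⟨ ℤ.∣-i∣≡∣i∣ (U n) ⟨
  ∣ c₁ (conj (ω ↑ n)) ∣   ≡⟨ cong (∣_∣ ∘ c₁) (conj-↑ ω n) ⟩
  ∣ c₁ (ω̄ ↑ n) ∣          ≡⟨ ∣c₁∣-≈± x≈ω̄↑n ⟨
  ∣ c₁ x ∣                ∎
  where open ≡-Reasoning

x²+19≡4·5ⁿ⇒ : ∀ x n → x ℕ.* x ℕ.+ 19 ≡ 4 ℕ.* 5 ^ n → n ≡ 1 ⊎ n ≡ 2 ⊎ n ≡ 7
x²+19≡4·5ⁿ⇒ x n eq with x divMod 2
... | result a 0F refl = contradiction 4∣19 (from-no (4 ℕ.∣? 19))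
  where
  even-square : ∀ a → a ℕ.* 2 ℕ.* (a ℕ.* 2) ≡ a ℕ.* a ℕ.* 4
  even-square = ℕ.solve-∀
  4∣19 : 4 ℕ.∣ 19
  4∣19 = ℕ.∣m+n∣m⇒∣n (subst (4 ℕ.∣_) (sym eq) (ℕ.m∣m*n (5 ^ n))) (ℕ.divides (a ℕ.* a) (even-square a))
... | result a 1F refl = ∣U∣≡1⇒ n (∣U∣≡∣c₁∣ n (descent n (+ a ∔ + 1 ·ω) N≡5ⁿ (5∤a+ω (+ a))))
  where
  odd-square : ∀ a → (1 ℕ.+ a ℕ.* 2) ℕ.* (1 ℕ.+ a ℕ.* 2) ℕ.+ 19 ≡ 4 ℕ.* (a ℕ.* a ℕ.+ a ℕ.+ 5)
  odd-square = ℕ.solve-∀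
  N≡5ⁿ : N (+ a ∔ + 1 ·ω) ≡ + (5 ^ n)
  N≡5ⁿ = trans (cong₂ _+_ (cong₂ _+_ (sym (ℤ.pos-* a a)) (ℤ.*-identityʳ (+ a))) refl)
               (cong +_ (ℕ.*-cancelˡ-≡ _ _ 4 (trans (sym (odd-square a)) eq)))

disc≡-19⇒ : ∀ q → disc q ≡ -[1+ 18 ] → floor2sqrt q ℕ.* floor2sqrt q ℕ.+ 19 ≡ 4 ℕ.* q
disc≡-19⇒ q disc≡-19 = ℤ.+-injective (begin
  + m² + + 19                                  ≡⟨ shift (+ m²) (+ (4 ℕ.* q)) ⟩
  (+ m² - + (4 ℕ.* q)) + (+ (4 ℕ.* q) + + 19)  ≡⟨ cong (_+ (+ (4 ℕ.* q) + + 19)) disc≡-19 ⟩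
  -[1+ 18 ] + (+ (4 ℕ.* q) + + 19)             ≡⟨ cancel (+ (4 ℕ.* q)) ⟩
  + (4 ℕ.* q)                                  ∎)
  where
  open ≡-Reasoning
  m² = floor2sqrt q ℕ.* floor2sqrt q
  shift : ∀ a b → a + + 19 ≡ (a - b) + (b + + 19)
  shift = solve-∀
  cancel : ∀ b → -[1+ 18 ] + (b + + 19) ≡ b
  cancel = solve-∀

proposition5p4 : (q : ℕ) → (IsPrimePower q × q % 5 ≡ 0 × disc q ≡ -[1+ 18 ]) ⇔ q ≡ 5 ^ 7
proposition5p4 q = mk⇔ (forward q) backward
  where
  forward : ∀ q → IsPrimePower q × q % 5 ≡ 0 × disc q ≡ -[1+ 18 ] → q ≡ 5 ^ 7
  forward _ ((p , k , p-prime , refl) , q%5≡0 , disc≡-19)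
    with prime∣prime^⇒≡ (suc k) prime-5 p-prime (ℕ.m%n≡0⇒n∣m _ 5 q%5≡0)
  ... | refl with x²+19≡4·5ⁿ⇒ (floor2sqrt (5 ^ suc k)) (suc k) (disc≡-19⇒ (5 ^ suc k) disc≡-19)
  ...   | inj₁ refl        = case disc≡-19 of λ ()
  ...   | inj₂ (inj₁ refl) = case disc≡-19 of λ ()
  ...   | inj₂ (inj₂ refl) = refl
  backward : ∀ {q} → q ≡ 5 ^ 7 → IsPrimePower q × q % 5 ≡ 0 × disc q ≡ -[1+ 18 ]
  backward refl = (5 , 6 , prime-5 , refl) , refl , refl
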